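{- Let $j\ge 1$ be an integer. There is a polynomial $A(j,r)\in\mathbb{Z}[r]$ of the form $A(j,r)=r^j+\frac32 j(j-1)r^{j-1}+(\text{terms of degree}<j-1)$ with $A(j,0)=0$ such that $F_{j+1}^{(r)}=A(j,r)/j!$ for every integer $r\ge 1$.
   Context: For a positive integer $r$, the convolved Fibonacci numbers $F_{j+1}^{(r)}$ ($j\ge0$) are defined by $(1-z-z^2)^{ -r}=\sum_{j\ge 0}F_{j+1}^{(r)}z^j$. -}

module Defs where

open import Data.Nat using (ℕ; zero; suc)
open import Data.Integer using (ℤ; _+_; _*_; _^_; 0ℤ; 1ℤ)

-- Formal power series over ℤ, represented by their coefficient sequences.
Series : Set
Series = ℕ → ℤ

sumTo : ℕ → (ℕ → ℤ) → ℤ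
sumTo zero    f = f zero
sumTo (suc n) f = sumTo n f + f (suc n)

_·_ : Series → Series → Series
(f · g) n = sumTo n (λ k → f k * g (n Data.Nat.∸ k))

oneS : Series
oneS zero    = 1ℤ
oneS (suc _) = 0ℤ

_^S_ : Series → ℕ → Series
f ^S zero  = oneS
f ^S suc r = f · (f ^S r)

-- (1 - z - z^2)^{-1}: the unique power series g with (1 - z - z^2) g = 1,
-- i.e. g_0 = 1, g_1 = 1, g_{n+2} = g_{n+1} + g_n.
invTrinom : Series
invTrinom zero          = 1ℤ
invTrinom (suc zero)    = 1ℤ
invTrinom (suc (suc n)) = invTrinom (suc n) + invTrinom n

-- convolved Fibonacci number F^{(r)}_{j+1} = [z^j] (1 - z - z^2)^{-r}
convFib : (r j : ℕ) → ℤ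
convFib r j = (invTrinom ^S r) j

evalPoly : (d : ℕ) → (ℕ → ℤ) → ℤ → ℤ
evalPoly d a x = sumTo d (λ i → a i * (x ^ i))

-- g = (1 - z - z²)^(-r) satisfies (1 - z - z²) g' = r (1 + 2z) g; by induction on r this holds because
-- multiplying by 1 - z - z² is injective and intertwines the defects for exponents r + 1 and r.
-- In coefficients, (n + 2) g_{n+2} = (r + n + 1) g_{n+1} + (2r + n) g_n, so A(j) = j! g_j obeys a
-- three-term recurrence with coefficients linear in r; induction on j then shows that A(j) is a
-- polynomial of degree j with leading coefficient 1, next coefficient 3j(j-1)/2 and no constant term.
module Submission where

open import Defs
open import Data.Nat using (ℕ; zero; suc; s≤s; _<_; _≤_; _∸_; _!)
open import Data.Nat.Properties using (≤-refl; n≤1+n; <-≤-trans)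
open import Data.Integer using (ℤ; +_; _+_; _-_; _*_; _^_; 0ℤ; 1ℤ)
open import Data.Integer.Properties
  using (+-identityˡ; +-identityʳ; +-assoc; +-commutativeSemigroup; *-zeroʳ; *-identityˡ; *-identityʳ;
         *-assoc; *-distribˡ-+; *-distribʳ-+; i-j≡0⇒i≡j; pos-*)
open import Algebra.Properties.CommutativeSemigroup +-commutativeSemigroup using (interchange)
open import Data.Integer.Tactic.RingSolver using (solve-∀; solve)
open import Data.List using (_∷_; [])
open import Data.Product using (Σ; _×_; _,_; proj₁)
open import Relation.Binary.PropositionalEquality using (_≡_; refl; sym; trans; cong; cong₂; _≗_)
open Relation.Binary.PropositionalEquality.≡-Reasoning

sumTo-cong : ∀ n {f g : ℕ → ℤ} → f ≗ g → sumTo n f ≡ sumTo n g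
sumTo-cong zero    f≗g = f≗g zero
sumTo-cong (suc n) f≗g = cong₂ _+_ (sumTo-cong n f≗g) (f≗g (suc n))

sumTo-+ : ∀ n (f g : ℕ → ℤ) → sumTo n (λ i → f i + g i) ≡ sumTo n f + sumTo n g
sumTo-+ zero    f g = refl
sumTo-+ (suc n) f g = begin
  sumTo n (λ i → f i + g i) + (f (suc n) + g (suc n))
    ≡⟨ cong (_+ (f (suc n) + g (suc n))) (sumTo-+ n f g) ⟩
  sumTo n f + sumTo n g + (f (suc n) + g (suc n))
    ≡⟨ interchange (sumTo n f) (sumTo n g) (f (suc n)) (g (suc n)) ⟩
  sumTo n f + f (suc n) + (sumTo n g + g (suc n)) ∎

sumTo-* : ∀ n c (f : ℕ → ℤ) → sumTo n (λ i → c * f i) ≡ c * sumTo n f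
sumTo-* zero    c f = refl
sumTo-* (suc n) c f = begin
  sumTo n (λ i → c * f i) + c * f (suc n)
    ≡⟨ cong (_+ c * f (suc n)) (sumTo-* n c f) ⟩
  c * sumTo n f + c * f (suc n)
    ≡⟨ *-distribˡ-+ c (sumTo n f) (f (suc n)) ⟨
  c * (sumTo n f + f (suc n)) ∎

sumTo-head : ∀ n (f : ℕ → ℤ) → sumTo (suc n) f ≡ f zero + sumTo n (λ i → f (suc i))
sumTo-head zero    f = refl
sumTo-head (suc n) f = begin
  sumTo (suc n) f + f (suc (suc n))
    ≡⟨ cong (_+ f (suc (suc n))) (sumTo-head n f) ⟩
  f zero + sumTo n (λ i → f (suc i)) + f (suc (suc n))
    ≡⟨ +-assoc (f zero) (sumTo n (λ i → f (suc i))) (f (suc (suc n))) ⟩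
  f zero + (sumTo n (λ i → f (suc i)) + f (suc (suc n))) ∎

trinomMul : Series → Series
trinomMul u zero          = u 0
trinomMul u (suc zero)    = u 1 - u 0
trinomMul u (suc (suc n)) = u (suc (suc n)) - u (suc n) - u n

invTrinom·-rec : ∀ h n →
  (invTrinom · h) (suc (suc n)) ≡ h (suc (suc n)) + (invTrinom · h) (suc n) + (invTrinom · h) n
invTrinom·-rec h n = begin
  sumTo (suc (suc n)) (λ k → invTrinom k * h (suc (suc n) ∸ k))
    ≡⟨ sumTo-head (suc n) _ ⟩
  1ℤ * h (suc (suc n)) + sumTo (suc n) (λ k → invTrinom (suc k) * h (suc n ∸ k))
    ≡⟨ cong (λ s → 1ℤ * h (suc (suc n)) + s) (sumTo-head n _) ⟩
  1ℤ * h (suc (suc n)) + (1ℤ * h (suc n) + sumTo n (λ k → (invTrinom (suc k) + invTrinom k) * h (n ∸ k)))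
    ≡⟨ cong (λ s → 1ℤ * h (suc (suc n)) + (1ℤ * h (suc n) + s)) split ⟩
  1ℤ * h (suc (suc n)) + (1ℤ * h (suc n) + (tail + u n))
    ≡⟨ regroup (h (suc (suc n))) (h (suc n)) tail (u n) ⟩
  h (suc (suc n)) + (1ℤ * h (suc n) + tail) + u n
    ≡⟨ cong (λ s → h (suc (suc n)) + s + u n) (sumTo-head n _) ⟨
  h (suc (suc n)) + u (suc n) + u n ∎
  where
  u : Series
  u = invTrinom · h
  tail : ℤ
  tail = sumTo n (λ k → invTrinom (suc k) * h (n ∸ k))
  split : sumTo n (λ k → (invTrinom (suc k) + invTrinom k) * h (n ∸ k)) ≡ tail + u n
  split = trans (sumTo-cong n (λ k → *-distribʳ-+ (h (n ∸ k)) (invTrinom (suc k)) (invTrinom k)))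
                (sumTo-+ n _ _)
  regroup : ∀ a b t w → 1ℤ * a + (1ℤ * b + (t + w)) ≡ a + (1ℤ * b + t) + w
  regroup = solve-∀

trinomMul-invTrinom· : ∀ h → trinomMul (invTrinom · h) ≗ h
trinomMul-invTrinom· h zero          = *-identityˡ (h 0)
trinomMul-invTrinom· h (suc zero)    = cancel (h 1) (h 0)
  where
  cancel : ∀ a b → 1ℤ * a + 1ℤ * b - 1ℤ * b ≡ a
  cancel = solve-∀
trinomMul-invTrinom· h (suc (suc n)) =
  trans (cong (λ s → s - u (suc n) - u n) (invTrinom·-rec h n)) (cancel (h (suc (suc n))) (u (suc n)) (u n))
  where
  u : Series
  u = invTrinom · h
  cancel : ∀ a b c → a + b + c - b - c ≡ a
  cancel = solve-∀

trinomMul≡0⇒≡0 : ∀ {s : Series} → (∀ n → trinomMul s n ≡ 0ℤ) → ∀ n → s n ≡ 0ℤ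
trinomMul≡0⇒≡0 {s} t≡0 n = proj₁ (consecutive n)
  where
  consecutive : ∀ n → s n ≡ 0ℤ × s (suc n) ≡ 0ℤ
  consecutive zero    = t≡0 0 , trans (i-j≡0⇒i≡j (s 1) (s 0) (t≡0 1)) (t≡0 0)
  consecutive (suc n) with consecutive n
  ... | sₙ≡0 , sₙ₊₁≡0 = sₙ₊₁≡0 , (begin
    s (suc (suc n))                    ≡⟨ drop-zeros (s (suc (suc n))) ⟨
    s (suc (suc n)) - 0ℤ - 0ℤ          ≡⟨ cong₂ (λ a b → s (suc (suc n)) - a - b) sₙ₊₁≡0 sₙ≡0 ⟨
    trinomMul s (suc (suc n))          ≡⟨ t≡0 (suc (suc n)) ⟩
    0ℤ                                 ∎)
    where
    drop-zeros : ∀ a → a - 0ℤ - 0ℤ ≡ a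
    drop-zeros = solve-∀

-- Coefficients of (1 - z - z²) g' - R (1 + 2z) g.
odeDefect : ℤ → Series → Series
odeDefect R g zero    = g 1 - R * g 0
odeDefect R g (suc n) =
  + suc (suc n) * g (suc (suc n)) - ((R + + suc n) * g (suc n) + (R + R + + n) * g n)

odeDefect-cong : ∀ R {f g} → f ≗ g → odeDefect R f ≗ odeDefect R g
odeDefect-cong R f≗g zero    rewrite f≗g 0 | f≗g 1 = refl
odeDefect-cong R f≗g (suc n) rewrite f≗g n | f≗g (suc n) | f≗g (suc (suc n)) = refl

-- With h = (1 - z - z²) u: (1 - z - z²) h' - R (1 + 2z) h = (1 - z - z²) ((1 - z - z²) u' - (R + 1) (1 + 2z) u).
trinomMul-odeDefect : ∀ R u → trinomMul (odeDefect (1ℤ + R) u) ≗ odeDefect R (trinomMul u)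
trinomMul-odeDefect R u zero = identity R (u 0) (u 1)
  where
  identity : ∀ R u₀ u₁ → u₁ - (1ℤ + R) * u₀ ≡ (u₁ - u₀) - R * u₀
  identity = solve-∀
trinomMul-odeDefect R u (suc zero) = identity R (u 0) (u 1) (u 2)
  where
  identity : ∀ R u₀ u₁ u₂ →
    + 2 * u₂ - (((1ℤ + R) + + 1) * u₁ + ((1ℤ + R) + (1ℤ + R) + + 0) * u₀) - (u₁ - (1ℤ + R) * u₀)
    ≡ + 2 * (u₂ - u₁ - u₀) - ((R + + 1) * (u₁ - u₀) + (R + R + + 0) * u₀)
  identity = solve-∀
trinomMul-odeDefect R u (suc (suc zero)) = identity R (u 0) (u 1) (u 2) (u 3)
  where
  identity : ∀ R u₀ u₁ u₂ u₃ →
    + 3 * u₃ - (((1ℤ + R) + + 2) * u₂ + ((1ℤ + R) + (1ℤ + R) + + 1) * u₁)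
    - (+ 2 * u₂ - (((1ℤ + R) + + 1) * u₁ + ((1ℤ + R) + (1ℤ + R) + + 0) * u₀))
    - (u₁ - (1ℤ + R) * u₀)
    ≡ + 3 * (u₃ - u₂ - u₁) - ((R + + 2) * (u₂ - u₁ - u₀) + (R + R + + 1) * (u₁ - u₀))
  identity = solve-∀
trinomMul-odeDefect R u (suc (suc (suc n))) =
  identity R (+ n) (u n) (u (suc n)) (u (suc (suc n))) (u (suc (suc (suc n)))) (u (suc (suc (suc (suc n)))))
  where
  identity : ∀ R N u₀ u₁ u₂ u₃ u₄ →
    (+ 4 + N) * u₄ - (((1ℤ + R) + (+ 3 + N)) * u₃ + ((1ℤ + R) + (1ℤ + R) + (+ 2 + N)) * u₂)
    - ((+ 3 + N) * u₃ - (((1ℤ + R) + (+ 2 + N)) * u₂ + ((1ℤ + R) + (1ℤ + R) + (+ 1 + N)) * u₁))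
    - ((+ 2 + N) * u₂ - (((1ℤ + R) + (+ 1 + N)) * u₁ + ((1ℤ + R) + (1ℤ + R) + N) * u₀))
    ≡ (+ 4 + N) * (u₄ - u₃ - u₂) - ((R + (+ 3 + N)) * (u₃ - u₂ - u₁) + (R + R + (+ 2 + N)) * (u₂ - u₁ - u₀))
  identity = solve-∀

odeDefect-convFib : ∀ r → odeDefect (+ r) (convFib r) ≗ λ _ → 0ℤ
odeDefect-convFib zero zero                = refl
odeDefect-convFib zero (suc zero)          = refl
odeDefect-convFib zero (suc (suc n))       =
  vanish (+ suc (suc (suc n))) (+ 0 + + suc (suc n)) (+ 0 + + 0 + + suc n)
  where
  vanish : ∀ a b c → a * 0ℤ - (b * 0ℤ + c * 0ℤ) ≡ 0ℤ
  vanish = solve-∀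
odeDefect-convFib (suc r) = trinomMul≡0⇒≡0 λ n → begin
  trinomMul (odeDefect (+ suc r) (convFib (suc r))) n  ≡⟨ trinomMul-odeDefect (+ r) (convFib (suc r)) n ⟩
  odeDefect (+ r) (trinomMul (convFib (suc r))) n      ≡⟨ odeDefect-cong (+ r) (trinomMul-invTrinom· (convFib r)) n ⟩
  odeDefect (+ r) (convFib r) n                        ≡⟨ odeDefect-convFib r n ⟩
  0ℤ                                                   ∎

convFib-initial : ∀ r → convFib r 0 ≡ 1ℤ
convFib-initial zero    = refl
convFib-initial (suc r) = trans (trinomMul-invTrinom· (convFib r) 0) (convFib-initial r)

convFib-rec₁ : ∀ r → convFib r 1 ≡ + r * convFib r 0
convFib-rec₁ r = i-j≡0⇒i≡j _ _ (odeDefect-convFib r 0)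

convFib-rec : ∀ r n → + suc (suc n) * convFib r (suc (suc n))
  ≡ (+ r + + suc n) * convFib r (suc n) + (+ r + + r + + n) * convFib r n
convFib-rec r n = i-j≡0⇒i≡j _ _ (odeDefect-convFib r (suc n))

DegreeAtMost : ℕ → (ℕ → ℤ) → Set
DegreeAtMost d p = ∀ i → d < i → p i ≡ 0ℤ

shift : (ℕ → ℤ) → ℕ → ℤ
shift p zero    = 0ℤ
shift p (suc i) = p i

linMul : ℤ → ℤ → (ℕ → ℤ) → ℕ → ℤ
linMul a b p i = a * shift p i + b * p i

DegreeAtMost-mono : ∀ {d e p} → d ≤ e → DegreeAtMost d p → DegreeAtMost e p
DegreeAtMost-mono d≤e deg i e<i = deg i (<-≤-trans (s≤s d≤e) e<i)

DegreeAtMost-+ : ∀ {d p q} → DegreeAtMost d p → DegreeAtMost d q → DegreeAtMost d (λ i → p i + q i)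
DegreeAtMost-+ degp degq i d<i = cong₂ _+_ (degp i d<i) (degq i d<i)

DegreeAtMost-linMul : ∀ {d p} a b → DegreeAtMost d p → DegreeAtMost (suc d) (linMul a b p)
DegreeAtMost-linMul {d} {p} a b deg (suc i) (s≤s d<i) = begin
  a * p i + b * p (suc i)  ≡⟨ cong₂ (λ x y → a * x + b * y) (deg i d<i) (deg (suc i) (<-≤-trans d<i (n≤1+n i))) ⟩
  a * 0ℤ + b * 0ℤ          ≡⟨ solve (a ∷ b ∷ []) ⟩
  0ℤ                       ∎

linMul-top : ∀ {d p} a b → DegreeAtMost d p → linMul a b p (suc d) ≡ a * p d
linMul-top {d} {p} a b deg = begin
  a * p d + b * p (suc d)  ≡⟨ cong (λ y → a * p d + b * y) (deg (suc d) ≤-refl) ⟩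
  a * p d + b * 0ℤ         ≡⟨ cong (λ y → a * p d + y) (*-zeroʳ b) ⟩
  a * p d + 0ℤ             ≡⟨ +-identityʳ (a * p d) ⟩
  a * p d                  ∎

evalPoly-+ : ∀ d p q x → evalPoly d (λ i → p i + q i) x ≡ evalPoly d p x + evalPoly d q x
evalPoly-+ d p q x = trans (sumTo-cong d (λ i → *-distribʳ-+ (x ^ i) (p i) (q i))) (sumTo-+ d _ _)

evalPoly-scale : ∀ d c p x → evalPoly d (λ i → c * p i) x ≡ c * evalPoly d p x
evalPoly-scale d c p x = trans (sumTo-cong d (λ i → *-assoc c (p i) (x ^ i))) (sumTo-* d c _)

evalPoly-shift : ∀ d p x → evalPoly (suc d) (shift p) x ≡ x * evalPoly d p x
evalPoly-shift d p x = begin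
  evalPoly (suc d) (shift p) x                 ≡⟨ sumTo-head d _ ⟩
  0ℤ + sumTo d (λ i → p i * (x * x ^ i))      ≡⟨ +-identityˡ _ ⟩
  sumTo d (λ i → p i * (x * x ^ i))           ≡⟨ sumTo-cong d (λ i → swap (p i) x (x ^ i)) ⟩
  sumTo d (λ i → x * (p i * x ^ i))           ≡⟨ sumTo-* d x _ ⟩
  x * evalPoly d p x                           ∎
  where
  swap : ∀ a x y → a * (x * y) ≡ x * (a * y)
  swap = solve-∀

evalPoly-extend : ∀ {d p} x → DegreeAtMost d p → evalPoly (suc d) p x ≡ evalPoly d p x
evalPoly-extend {d} {p} x deg = begin
  evalPoly d p x + p (suc d) * x ^ suc d  ≡⟨ cong (λ c → evalPoly d p x + c * x ^ suc d) (deg (suc d) ≤-refl) ⟩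
  evalPoly d p x + 0ℤ                     ≡⟨ +-identityʳ _ ⟩
  evalPoly d p x                          ∎

evalPoly-linMul : ∀ {d p} a b x → DegreeAtMost d p →
  evalPoly (suc d) (linMul a b p) x ≡ (a * x + b) * evalPoly d p x
evalPoly-linMul {d} {p} a b x deg = begin
  evalPoly (suc d) (linMul a b p) x
    ≡⟨ evalPoly-+ (suc d) (λ i → a * shift p i) (λ i → b * p i) x ⟩
  evalPoly (suc d) (λ i → a * shift p i) x + evalPoly (suc d) (λ i → b * p i) x
    ≡⟨ cong₂ _+_ (evalPoly-scale (suc d) a (shift p) x) (evalPoly-scale (suc d) b p x) ⟩
  a * evalPoly (suc d) (shift p) x + b * evalPoly (suc d) p x
    ≡⟨ cong₂ (λ s t → a * s + b * t) (evalPoly-shift d p x) (evalPoly-extend x deg) ⟩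
  a * (x * evalPoly d p x) + b * evalPoly d p x
    ≡⟨ factor a b x (evalPoly d p x) ⟩
  (a * x + b) * evalPoly d p x ∎
  where
  factor : ∀ a b x e → a * (x * e) + b * e ≡ (a * x + b) * e
  factor = solve-∀

evalPoly-at-0 : ∀ d p → evalPoly d p 0ℤ ≡ p 0
evalPoly-at-0 zero    p = *-identityʳ (p 0)
evalPoly-at-0 (suc d) p = trans (cong₂ _+_ (evalPoly-at-0 d p) (*-zeroʳ (p (suc d)))) (+-identityʳ (p 0))

linMul-constant : ∀ a b p → p 0 ≡ 0ℤ → linMul a b p 0 ≡ 0ℤ
linMul-constant a b p p₀≡0 = begin
  a * 0ℤ + b * p 0   ≡⟨ cong (λ y → a * 0ℤ + b * y) p₀≡0 ⟩
  a * 0ℤ + b * 0ℤ    ≡⟨ solve (a ∷ b ∷ []) ⟩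
  0ℤ                 ∎

-- A(j) = j! F^{(r)}_{j+1} as a polynomial in r: multiplying the recurrence of convFib-rec by (j+1)!
-- gives A(j+2) = (r + j + 1) A(j+1) + (j+1) (2r + j) A(j).
convFibPoly : ℕ → ℕ → ℤ
convFibPoly zero          i = oneS i
convFibPoly (suc zero)    i = linMul 1ℤ 0ℤ oneS i
convFibPoly (suc (suc j)) i =
  linMul 1ℤ (+ suc j) (convFibPoly (suc j)) i + linMul (+ 2 * + suc j) (+ suc j * + j) (convFibPoly j) i

convFibPoly-degree : ∀ j → DegreeAtMost j (convFibPoly j)
convFibPoly-degree zero          (suc i) _ = refl
convFibPoly-degree (suc zero)              = DegreeAtMost-linMul 1ℤ 0ℤ (convFibPoly-degree 0)
convFibPoly-degree (suc (suc j))           =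
  DegreeAtMost-+ (DegreeAtMost-linMul 1ℤ (+ suc j) (convFibPoly-degree (suc j)))
                 (DegreeAtMost-mono (n≤1+n _)
                    (DegreeAtMost-linMul (+ 2 * + suc j) (+ suc j * + j) (convFibPoly-degree j)))

convFibPoly-leading : ∀ j → convFibPoly j j ≡ 1ℤ
convFibPoly-leading zero          = refl
convFibPoly-leading (suc zero)    = refl
convFibPoly-leading (suc (suc j)) = begin
  linMul 1ℤ c (convFibPoly (suc j)) (suc (suc j)) + linMul (+ 2 * c) (c * + j) (convFibPoly j) (suc (suc j))
    ≡⟨ cong₂ _+_ (linMul-top 1ℤ c (convFibPoly-degree (suc j)))
                 (DegreeAtMost-linMul (+ 2 * c) (c * + j) (convFibPoly-degree j) (suc (suc j)) ≤-refl) ⟩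
  1ℤ * convFibPoly (suc j) (suc j) + 0ℤ
    ≡⟨ cong (λ a → 1ℤ * a + 0ℤ) (convFibPoly-leading (suc j)) ⟩
  1ℤ ∎
  where
  c : ℤ
  c = + suc j

convFibPoly-subleading : ∀ j → + 2 * convFibPoly (suc j) j ≡ + 3 * + suc j * + j
convFibPoly-subleading zero    = refl
convFibPoly-subleading (suc j) = begin
  + 2 * ((1ℤ * X + c * convFibPoly (suc j) (suc j)) + (+ 2 * c * convFibPoly j j + c * + j * convFibPoly j (suc j)))
    ≡⟨ cong (λ s → + 2 * s)
         (cong₂ _+_ (cong (λ y → 1ℤ * X + c * y) (convFibPoly-leading (suc j)))
                    (cong₂ (λ y z → + 2 * c * y + c * + j * z)
                           (convFibPoly-leading j) (convFibPoly-degree j (suc j) ≤-refl))) ⟩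
  + 2 * ((1ℤ * X + c * 1ℤ) + (+ 2 * c * 1ℤ + c * + j * 0ℤ))
    ≡⟨ expand X (+ j) ⟩
  + 2 * X + + 6 * c
    ≡⟨ cong (λ s → s + + 6 * c) (convFibPoly-subleading j) ⟩
  + 3 * c * + j + + 6 * c
    ≡⟨ collect (+ j) ⟩
  + 3 * + suc (suc j) * c ∎
  where
  c X : ℤ
  c = + suc j
  X = convFibPoly (suc j) j
  expand : ∀ X J → + 2 * ((1ℤ * X + (1ℤ + J) * 1ℤ) + (+ 2 * (1ℤ + J) * 1ℤ + (1ℤ + J) * J * 0ℤ))
                   ≡ + 2 * X + + 6 * (1ℤ + J)
  expand = solve-∀
  collect : ∀ J → + 3 * (1ℤ + J) * J + + 6 * (1ℤ + J) ≡ + 3 * (1ℤ + (1ℤ + J)) * (1ℤ + J)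
  collect = solve-∀

convFibPoly-constant : ∀ j → convFibPoly (suc j) 0 ≡ 0ℤ
convFibPoly-constant zero          = refl
convFibPoly-constant (suc zero)    = refl
convFibPoly-constant (suc (suc j)) =
  cong₂ _+_ (linMul-constant 1ℤ c (convFibPoly (suc (suc j))) (convFibPoly-constant (suc j)))
            (linMul-constant (+ 2 * c) (c * + suc j) (convFibPoly (suc j)) (convFibPoly-constant j))
  where
  c : ℤ
  c = + suc (suc j)

evalPoly-convFibPoly : ∀ j x →
  evalPoly (suc (suc j)) (convFibPoly (suc (suc j))) x
  ≡ (1ℤ * x + + suc j) * evalPoly (suc j) (convFibPoly (suc j)) x
    + (+ 2 * + suc j * x + + suc j * + j) * evalPoly j (convFibPoly j) x
evalPoly-convFibPoly j x =
  trans (evalPoly-+ (suc (suc j)) (linMul 1ℤ (+ suc j) (convFibPoly (suc j)))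
                                  (linMul (+ 2 * + suc j) (+ suc j * + j) (convFibPoly j)) x)
        (cong₂ _+_ (evalPoly-linMul 1ℤ (+ suc j) x (convFibPoly-degree (suc j)))
                   (trans (evalPoly-extend x (DegreeAtMost-linMul a b (convFibPoly-degree j)))
                          (evalPoly-linMul a b x (convFibPoly-degree j))))
  where
  a b : ℤ
  a = + 2 * + suc j
  b = + suc j * + j

factorial-suc : ∀ n → + (suc n !) ≡ + suc n * + (n !)
factorial-suc n = pos-* (suc n) (n !)

scaled-recurrence : ∀ x J F g₀ g₁ g₂ →
  (+ 2 + J) * g₂ ≡ (x + (1ℤ + J)) * g₁ + (x + x + J) * g₀ →
  (+ 2 + J) * ((1ℤ + J) * F) * g₂
  ≡ (1ℤ * x + (1ℤ + J)) * ((1ℤ + J) * F * g₁) + (+ 2 * (1ℤ + J) * x + (1ℤ + J) * J) * (F * g₀)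
scaled-recurrence x J F g₀ g₁ g₂ rec = begin
  (+ 2 + J) * ((1ℤ + J) * F) * g₂
    ≡⟨ solve (x ∷ J ∷ F ∷ g₀ ∷ g₁ ∷ g₂ ∷ []) ⟩
  (1ℤ + J) * F * ((+ 2 + J) * g₂)
    ≡⟨ cong (λ s → (1ℤ + J) * F * s) rec ⟩
  (1ℤ + J) * F * ((x + (1ℤ + J)) * g₁ + (x + x + J) * g₀)
    ≡⟨ solve (x ∷ J ∷ F ∷ g₀ ∷ g₁ ∷ g₂ ∷ []) ⟩
  (1ℤ * x + (1ℤ + J)) * ((1ℤ + J) * F * g₁) + (+ 2 * (1ℤ + J) * x + (1ℤ + J) * J) * (F * g₀) ∎

convFib≡convFibPoly : ∀ r j → + (j !) * convFib r j ≡ evalPoly j (convFibPoly j) (+ r)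
convFib≡convFibPoly r zero          = trans (*-identityˡ _) (convFib-initial r)
convFib≡convFibPoly r (suc zero)    = begin
  1ℤ * convFib r 1               ≡⟨ *-identityˡ _ ⟩
  convFib r 1                    ≡⟨ convFib-rec₁ r ⟩
  + r * convFib r 0              ≡⟨ cong (λ g → + r * g) (convFib-initial r) ⟩
  + r * 1ℤ                       ≡⟨ linear (+ r) ⟩
  (1ℤ * + r + 0ℤ) * 1ℤ           ≡⟨ evalPoly-linMul 1ℤ 0ℤ (+ r) (convFibPoly-degree 0) ⟨
  evalPoly 1 (convFibPoly 1) (+ r) ∎
  where
  linear : ∀ x → x * 1ℤ ≡ (1ℤ * x + 0ℤ) * 1ℤ
  linear = solve-∀
convFib≡convFibPoly r (suc (suc j)) = begin
  + (suc (suc j) !) * convFib r (suc (suc j))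
    ≡⟨ cong (λ f → f * convFib r (suc (suc j)))
            (trans (factorial-suc (suc j)) (cong (λ f → + suc (suc j) * f) (factorial-suc j))) ⟩
  + suc (suc j) * (+ suc j * + (j !)) * convFib r (suc (suc j))
    ≡⟨ scaled-recurrence (+ r) (+ j) (+ (j !)) _ _ _ (convFib-rec r j) ⟩
  (1ℤ * + r + + suc j) * (+ suc j * + (j !) * convFib r (suc j))
    + (+ 2 * + suc j * + r + + suc j * + j) * (+ (j !) * convFib r j)
    ≡⟨ cong₂ (λ s t → (1ℤ * + r + + suc j) * s + (+ 2 * + suc j * + r + + suc j * + j) * t)
             (trans (cong (λ f → f * convFib r (suc j)) (sym (factorial-suc j))) (convFib≡convFibPoly r (suc j)))
             (convFib≡convFibPoly r j) ⟩
  (1ℤ * + r + + suc j) * evalPoly (suc j) (convFibPoly (suc j)) (+ r)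
    + (+ 2 * + suc j * + r + + suc j * + j) * evalPoly j (convFibPoly j) (+ r)
    ≡⟨ evalPoly-convFibPoly j (+ r) ⟨
  evalPoly (suc (suc j)) (convFibPoly (suc (suc j))) (+ r) ∎

theorem5 : (j : ℕ) → 1 ≤ j →
    Σ (ℕ → ℤ) λ A →
      ((i : ℕ) → j < i → A i ≡ 0ℤ)
      × A j ≡ 1ℤ
      × (+ 2) * A (j ∸ 1) ≡ (+ 3) * (+ j) * (+ (j ∸ 1))
      × evalPoly j A 0ℤ ≡ 0ℤ
      × ((r : ℕ) → 1 ≤ r → (+ (j !)) * convFib r j ≡ evalPoly j A (+ r))
theorem5 (suc j) _ =
  convFibPoly (suc j) ,
  convFibPoly-degree (suc j) ,
  convFibPoly-leading (suc j) ,
  convFibPoly-subleading j ,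
  trans (evalPoly-at-0 (suc j) (convFibPoly (suc j))) (convFibPoly-constant j) ,
  λ r _ → convFib≡convFibPoly r (suc j)
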